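{- For every $k\ge2$, the randomized online algorithm PrGBA (defined in the context) is $4/3$-competitive for $k$S2L-S: on every instance its expected number of accepted requests is at least $\tfrac34\cdot$OPT.
   Context: Problem $k$S2L (car sharing with two locations). There are two locations $0$ and $1$ and $k$ servers. Time is divided into stages $i=1,2,3,\dots$. A request of a stage is either a "(0,1)" (pick up at location 0, drop off at 1) or a "(1,0)". Each server serves at most one request per stage; a server that serves a (0,1) in stage $i$ can only be used for a (1,0) (or left unused) in stage $i+1$, and symmetrically; a server unused in stage $i$ may be moved for free and used in stage $i+1$ for either direction. Before stage 1 all servers count as unused. Formally, if $\ell_i,r_i$ are the numbers of accepted (0,1)'s and (1,0)'s in stage $i$ and $f_i=k-\ell_i-r_i$, with $\ell_0=r_0=0$, $f_0=k$, a choice is feasible iff for all $i\ge1$: $\ell_i$ (resp. $r_i$) is at most the number of (0,1) (resp. (1,0)) requests of stage $i$, $\ell_i\le r_{i-1}+f_{i-1}$, $r_i\le\ell_{i-1}+f_{i-1}$, $\ell_i+r_i\le k$. Profit = total number of accepted requests; OPT = maximum feasible profit of the (finite) instance. In $k$S2L-S, in each stage $i$ the online algorithm sees the numbers $I\ell_i$ of (0,1)'s and $Ir_i$ of (1,0)'s of stage $i$ (and the past) and then decides, without knowledge of future stages. A (randomized) online algorithm is $1/\delta$-competitive if on every instance its expected profit is at least $\delta\cdot$OPT. Probabilistic rounding: for real $x\ge0$, $\mathrm{prrd}(x)$ equals $\lceil x\rceil$ with probability $x-\lfloor x\rfloor$ and $\lfloor x\rfloor$ otherwise. Algorithm PrGBA.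 Let $G\ell_0=Gr_0=0$, $Gf_0=k$; $Gf_{i-1}=k-G\ell_{i-1}-Gr_{i-1}$. In stage $i$ it accepts $G\ell_i$ (0,1)'s and $Gr_i$ (1,0)'s: if $Gr_{i-1}+Gf_{i-1}\le\lfloor k/2\rfloor$ or $I\ell_i\le\lfloor k/2\rfloor$, then $G\ell_i=\min\{I\ell_i,Gr_{i-1}+Gf_{i-1}\}$, $Gr_i=\min\{Ir_i,G\ell_{i-1}+Gf_{i-1},k-G\ell_i\}$; otherwise, if $G\ell_{i-1}+Gf_{i-1}\le\lfloor k/2\rfloor$ or $Ir_i\le\lfloor k/2\rfloor$, then $Gr_i=\min\{Ir_i,G\ell_{i-1}+Gf_{i-1}\}$, $G\ell_i=\min\{I\ell_i,Gr_{i-1}+Gf_{i-1},k-Gr_i\}$; otherwise $Gr_i=\mathrm{prrd}(k/2)$ and $G\ell_i=k-Gr_i$. -}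

module Defs where

open import Data.Nat using (ℕ; zero; suc; _+_; _*_; _∸_; _^_; _≤_; _⊓_; _≤ᵇ_)
open import Data.Nat.DivMod using (_/_)
open import Data.Bool using (Bool; true; false; if_then_else_; _∨_)
open import Data.Product using (_×_; _,_)
open import Data.Unit using (⊤)
open import Data.Vec using (Vec; []; _∷_)
open import Data.List using (List; []; _∷_; map; _++_)
open import Data.Nat.ListAction using (sum)

-- A request instance with n stages: stage i gives (Iℓ_i , Ir_i).
Instance : ℕ → Set
Instance n = Vec (ℕ × ℕ) n

Choice : ℕ → Set
Choice n = Vec (ℕ × ℕ) n

-- Feasibility for kS2L with k servers; pℓ pr are ℓ_{i-1}, r_{i-1},
-- f_{i-1} = k - ℓ_{i-1} - r_{i-1}.
Feasible : (k : ℕ) → ℕ → ℕ → {n : ℕ} → Instance n → Choice n → Set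
Feasible k pℓ pr [] [] = ⊤
Feasible k pℓ pr ((Iℓ , Ir) ∷ I) ((ℓ , r) ∷ S) =
  ℓ ≤ Iℓ × r ≤ Ir × ℓ ≤ pr + (k ∸ pℓ ∸ pr) × r ≤ pℓ + (k ∸ pℓ ∸ pr)
  × ℓ + r ≤ k × Feasible k ℓ r I S

profit : {n : ℕ} → Choice n → ℕ
profit [] = 0
profit ((ℓ , r) ∷ S) = ℓ + r + profit S

half : ℕ → ℕ
half k = k / 2

-- prrd (k/2) driven by a fair coin: true ↦ ⌈k/2⌉, false ↦ ⌊k/2⌋.
-- (For odd k each has probability 1/2; for even k both coincide.)
prrdHalf : ℕ → Bool → ℕ
prrdHalf k b = if b then k ∸ half k else half k

stepPrGBA : (k : ℕ) → ℕ × ℕ → ℕ × ℕ → Bool → ℕ × ℕ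
stepPrGBA k (gℓ , gr) (Iℓ , Ir) b =
  if ((gr + gf) ≤ᵇ half k) ∨ (Iℓ ≤ᵇ half k)
  then (let ℓ' = Iℓ ⊓ (gr + gf) in ℓ' , (Ir ⊓ (gℓ + gf)) ⊓ (k ∸ ℓ'))
  else (if ((gℓ + gf) ≤ᵇ half k) ∨ (Ir ≤ᵇ half k)
        then (let r' = Ir ⊓ (gℓ + gf) in (Iℓ ⊓ (gr + gf)) ⊓ (k ∸ r') , r')
        else (k ∸ prrdHalf k b , prrdHalf k b))
  where gf = k ∸ gℓ ∸ gr

runPrGBA : (k : ℕ) → ℕ × ℕ → {n : ℕ} → Instance n → Vec Bool n → Choice n
runPrGBA k prev [] [] = []
runPrGBA k prev (x ∷ I) (b ∷ bs) =
  let g = stepPrGBA k prev x b in g ∷ runPrGBA k g I bs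

-- All coin sequences of length n (2^n of them, each with probability 2^-n).
allBits : (n : ℕ) → List (Vec Bool n)
allBits zero = [] ∷ []
allBits (suc n) = map (true ∷_) (allBits n) ++ map (false ∷_) (allBits n)

-- 2^n times the expected profit of PrGBA on instance I.
totalProfitPrGBA : (k : ℕ) → {n : ℕ} → Instance n → ℕ
totalProfitPrGBA k {n} I = sum (map (λ bs → profit (runPrGBA k (0 , 0) I bs)) (allBits n))

-- Amortised analysis with the potential
--   Ψ = max (0 , 4a − k − 3p , 4b − k − 3q),
-- where PrGBA accepted a (0,1)'s and b (1,0)'s in the previous stage and the
-- offline solution accepted p and q.  Every stage satisfies
--   3·(gain of OPT) + E[Ψ after] ≤ 4·E[gain of PrGBA] + Ψ before,
-- and summing from Ψ = 0 gives 3·OPT ≤ 4·E[PrGBA].  In a greedy stage OPT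
-- accepts ℓ ≤ k − p (0,1)'s, and 4a ≤ k + 3p + Ψ turns this into
-- 3ℓ ≤ 4(k − a) + Ψ, a bound by PrGBA's own capacity k − a (likewise for
-- (1,0)'s).  In a rounded stage PrGBA accepts k requests whatever the coin,
-- and the potentials left by the two outcomes are bounded jointly.
module Submission where

open import Defs
open import Data.Nat using (ℕ; _+_; _*_; _^_; _≤_)
open import Data.Vec using (Vec)
open import Data.Nat using (zero; suc; _∸_; _⊓_; _⊔_; _≤ᵇ_; z≤n; s≤s⁻¹)
open import Data.Nat.Properties
open import Data.Nat.DivMod using (_%_; m≡m%n+[m/n]*n; m%n<n; m/n*n≤m; m/n≤m; /-monoˡ-≤)
open import Data.Nat.ListAction using (sum)
open import Data.Nat.ListAction.Properties using (sum-++)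
open import Data.Nat.Tactic.RingSolver using (solve; solve-∀)
open import Algebra.Properties.CommutativeSemigroup +-commutativeSemigroup using (xy∙z≈xz∙y)
open import Data.Bool using (Bool; true; false; _∨_)
open import Data.Bool.Properties using (T-∨; T-≡; if-cong)
open import Data.Product using (_×_; _,_)
open import Data.Sum using (_⊎_; inj₁; inj₂; [_,_])
import Data.Sum as Sum
open import Data.List using (List; []; _∷_; map; _++_; length)
open import Data.List.Properties using (map-++; map-∘; length-++; length-map)
import Data.Vec as Vec
open import Function.Bundles using (Equivalence)
open import Relation.Binary.PropositionalEquality using (_≡_; refl; sym; trans; cong; cong₂; subst; subst₂; module ≡-Reasoning)
open import Relation.Nullary using (yes; no)

-- A linear inequality m ≤ n is certified by one known inequality a ≤ b and
-- the semiring identity n + a ≡ m + b + c (left to the ring solver).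
≤-by-identity : ∀ {m n a b} c → a ≤ b → n + a ≡ m + b + c → m ≤ n
≤-by-identity {m} {n} {a} {b} c a≤b eq = +-cancelʳ-≤ a m n (begin
    m + a      ≤⟨ +-monoʳ-≤ m a≤b ⟩
    m + b      ≤⟨ m≤m+n (m + b) c ⟩
    m + b + c  ≡⟨ sym eq ⟩
    n + a      ∎)
  where open ≤-Reasoning

-- *-monoʳ-≤ with its type unfolded, so that the ring solver can read it.
*-monoʳ-≤′ : ∀ c {m n} → m ≤ n → c * m ≤ c * n
*-monoʳ-≤′ c = *-monoʳ-≤ c

+-∸-≤ : ∀ {w z} m n → w ≤ z → w + m ≤ z + n → w + (m ∸ n) ≤ z
+-∸-≤ {w} {z} m n w≤z w+m≤z+n with m ≤? n
... | yes m≤n rewrite m≤n⇒m∸n≡0 m≤n | +-identityʳ w = w≤z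
... | no m≰n = +-cancelʳ-≤ n (w + (m ∸ n)) z (begin
      w + (m ∸ n) + n  ≡⟨ +-assoc w (m ∸ n) n ⟩
      w + (m ∸ n + n)  ≡⟨ cong (w +_) (m∸n+n≡m (≰⇒≥ m≰n)) ⟩
      w + m            ≤⟨ w+m≤z+n ⟩
      z + n            ∎)
  where open ≤-Reasoning

+-⊔-≤ : ∀ {w z} x y → w + x ≤ z → w + y ≤ z → w + (x ⊔ y) ≤ z
+-⊔-≤ {w} x y w+x≤z w+y≤z = subst (_≤ _) (sym (+-distribˡ-⊔ w x y)) (⊔-lub w+x≤z w+y≤z)

x+[y⊓[k∸x]]≤k : ∀ {k x} y → x ≤ k → x + (y ⊓ (k ∸ x)) ≤ k
x+[y⊓[k∸x]]≤k {k} {x} y x≤k = begin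
  x + (y ⊓ (k ∸ x))  ≤⟨ +-monoʳ-≤ x (m⊓n≤n y (k ∸ x)) ⟩
  x + (k ∸ x)        ≡⟨ m+[n∸m]≡n x≤k ⟩
  k                  ∎
  where open ≤-Reasoning

⊓-∸-sel : ∀ {k x} y c → x ≤ k → let z = (y ⊓ c) ⊓ (k ∸ x) in z ≡ y ⊎ z ≡ c ⊎ x + z ≡ k
⊓-∸-sel {k} {x} y c x≤k with ⊓-sel (y ⊓ c) (k ∸ x)
... | inj₂ z≡k∸x = inj₂ (inj₂ (trans (cong (x +_) z≡k∸x) (m+[n∸m]≡n x≤k)))
... | inj₁ z≡y⊓c with ⊓-sel y c
...   | inj₁ y⊓c≡y = inj₁ (trans z≡y⊓c y⊓c≡y)
...   | inj₂ y⊓c≡c = inj₂ (inj₁ (trans z≡y⊓c y⊓c≡c))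

≤ᵇ-∨-true : ∀ {m n h} → (m ≤ᵇ h) ∨ (n ≤ᵇ h) ≡ true → m ≤ h ⊎ n ≤ h
≤ᵇ-∨-true {m} {n} {h} e =
  Sum.map (≤ᵇ⇒≤ m h) (≤ᵇ⇒≤ n h) (Equivalence.to T-∨ (Equivalence.from T-≡ e))

twice-half≤ : ∀ k → 2 * half k ≤ k
twice-half≤ k = subst (_≤ k) (*-comm (half k) 2) (m/n*n≤m k 2)

half≤ceil : ∀ k → half k ≤ k ∸ half k
half≤ceil k = m+n≤o⇒m≤o∸n (half k)
  (subst (λ h → half k + h ≤ k) (+-identityʳ (half k)) (twice-half≤ k))

ceil≤half+1 : ∀ k → k ∸ half k ≤ half k + 1
ceil≤half+1 k = m≤n+o⇒m∸n≤o k (half k) (begin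
  k                              ≡⟨ m≡m%n+[m/n]*n k 2 ⟩
  k % 2 + half k * 2             ≤⟨ +-monoˡ-≤ (half k * 2) (s≤s⁻¹ (m%n<n k 2)) ⟩
  1 + half k * 2                 ≡⟨ shuffle (half k) ⟩
  half k + (half k + 1)          ∎)
  where
    open ≤-Reasoning
    shuffle : ∀ h → 1 + h * 2 ≡ h + (h + 1)
    shuffle = solve-∀

ceil+half≡k : ∀ k → (k ∸ half k) + half k ≡ k
ceil+half≡k k = m∸n+n≡m (m/n≤m k 2)

1≤half : ∀ {k} → 2 ≤ k → 1 ≤ half k
1≤half 2≤k = /-monoˡ-≤ 2 2≤k

prrdHalf≤k : ∀ k c → prrdHalf k c ≤ k
prrdHalf≤k k true  = m∸n≤m k (half k)
prrdHalf≤k k false = m/n≤m k 2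

twice≤⇒≤ : ∀ {m n} → 2 * m ≤ n → m ≤ n
twice≤⇒≤ {m} = ≤-trans (m≤m+n m (1 * m))

twice-⊓≤ : ∀ {k} m n → n ≤ half k ⊎ m ≤ half k → 2 * (m ⊓ n) ≤ k
twice-⊓≤ {k} m n small = ≤-trans (*-monoʳ-≤ 2 m⊓n≤half) (twice-half≤ k)
  where
    m⊓n≤half : m ⊓ n ≤ half k
    m⊓n≤half = [ m≤n⇒o⊓m≤n m , m≤n⇒m⊓o≤n n ] small

-- capℓ and capr are the paper's Gr_{i−1} + Gf_{i−1} and Gℓ_{i−1} + Gf_{i−1}.
capℓ : ℕ → ℕ → ℕ → ℕ
capℓ k a b = b + (k ∸ a ∸ b)

capr : ℕ → ℕ → ℕ → ℕ
capr k a b = a + (k ∸ a ∸ b)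

free+used≡k : ∀ {k} a b → a + b ≤ k → (k ∸ a ∸ b) + (a + b) ≡ k
free+used≡k {k} a b a+b≤k = trans (cong (_+ (a + b)) (∸-+-assoc k a b)) (m∸n+n≡m a+b≤k)

capℓ+a≡k : ∀ {k} a b → a + b ≤ k → capℓ k a b + a ≡ k
capℓ+a≡k {k} a b a+b≤k = trans (shuffle b (k ∸ a ∸ b) a) (free+used≡k a b a+b≤k)
  where
    shuffle : ∀ b f a → b + f + a ≡ f + (a + b)
    shuffle = solve-∀

capr+b≡k : ∀ {k} a b → a + b ≤ k → capr k a b + b ≡ k
capr+b≡k {k} a b a+b≤k = trans (shuffle a (k ∸ a ∸ b) b) (free+used≡k a b a+b≤k)
  where
    shuffle : ∀ a f b → a + f + b ≡ f + (a + b)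
    shuffle = solve-∀

k≤c₁+c₂ : ∀ {k a b c₁ c₂} → c₁ + a ≡ k → c₂ + b ≡ k → a + b ≤ k → k ≤ c₁ + c₂
k≤c₁+c₂ {k} {a} {b} {c₁} {c₂} e₁ e₂ a+b≤k = ≤-by-identity 0
  (+-mono-≤ (+-mono-≤ (≤-reflexive (sym e₁)) (≤-reflexive (sym e₂))) a+b≤k)
  (solve (k ∷ a ∷ b ∷ c₁ ∷ c₂ ∷ []))

k≤capℓ+capr : ∀ {k} a b → a + b ≤ k → k ≤ capℓ k a b + capr k a b
k≤capℓ+capr {k} a b a+b≤k = k≤c₁+c₂ {k} {a} {b} {capℓ k a b} {capr k a b}
  (capℓ+a≡k a b a+b≤k) (capr+b≡k a b a+b≤k) a+b≤k

potential : ℕ → ℕ × ℕ → ℕ × ℕ → ℕ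
potential k (a , b) (p , q) = (4 * b ∸ (k + 3 * q)) ⊔ (4 * a ∸ (k + 3 * p))

potential-origin : ∀ k → potential k (0 , 0) (0 , 0) ≡ 0
potential-origin k = cong₂ _⊔_ (0∸n≡0 (k + 0)) (0∸n≡0 (k + 0))

potential-mirror : ∀ k a b p q → potential k (b , a) (q , p) ≡ potential k (a , b) (p , q)
potential-mirror k a b p q = ⊔-comm (4 * a ∸ (k + 3 * p)) (4 * b ∸ (k + 3 * q))

4a≤k+3p+potential : ∀ k a b p q → 4 * a ≤ k + 3 * p + potential k (a , b) (p , q)
4a≤k+3p+potential k a b p q = ≤-trans (m≤n+m∸n (4 * a) (k + 3 * p))
  (+-monoʳ-≤ (k + 3 * p) (m≤n⊔m (4 * b ∸ (k + 3 * q)) (4 * a ∸ (k + 3 * p))))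

4b≤k+3q+potential : ∀ k a b p q → 4 * b ≤ k + 3 * q + potential k (a , b) (p , q)
4b≤k+3q+potential k a b p q = subst (λ Ψ → 4 * b ≤ k + 3 * q + Ψ)
  (potential-mirror k a b p q) (4a≤k+3p+potential k b a q p)

+-potential-≤ : ∀ {k a b p q w z} → w ≤ z →
  w + 4 * b ≤ z + (k + 3 * q) → w + 4 * a ≤ z + (k + 3 * p) →
  w + potential k (a , b) (p , q) ≤ z
+-potential-≤ {w = w} w≤z hb ha = +-⊔-≤ {w} _ _ (+-∸-≤ _ _ w≤z hb) (+-∸-≤ _ _ w≤z ha)

opt-below-capacity : ∀ {k P a p ℓ c} → 4 * a ≤ k + 3 * p + P → ℓ + p ≤ k → c + a ≡ k →
  3 * ℓ ≤ 4 * c + P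
opt-below-capacity {P = P} {a} {p} {ℓ} {c} 4a≤ ℓ+p≤k refl =
  ≤-by-identity 0 (+-mono-≤ 4a≤ (*-monoʳ-≤′ 3 ℓ+p≤k)) (solve (P ∷ a ∷ p ∷ ℓ ∷ c ∷ []))

opt-below-capℓ : ∀ {k} a b p q {ℓ} → a + b ≤ k → ℓ + p ≤ k →
  3 * ℓ ≤ 4 * capℓ k a b + potential k (a , b) (p , q)
opt-below-capℓ {k} a b p q {ℓ} a+b≤k ℓ+p≤k =
  opt-below-capacity {a = a} {p} {ℓ} {capℓ k a b} (4a≤k+3p+potential k a b p q) ℓ+p≤k (capℓ+a≡k a b a+b≤k)

opt-below-capr : ∀ {k} a b p q {r} → a + b ≤ k → r + q ≤ k →
  3 * r ≤ 4 * capr k a b + potential k (a , b) (p , q)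
opt-below-capr {k} a b p q {r} a+b≤k r+q≤k =
  opt-below-capacity {a = b} {q} {r} {capr k a b} (4b≤k+3q+potential k a b p q) r+q≤k (capr+b≡k a b a+b≤k)

greedy-bound-side : ∀ {k P c I ℓ x} → ℓ ≤ I → 3 * ℓ ≤ 4 * c + P → x ≡ I ⊎ x ≡ c →
  3 * ℓ ≤ 4 * x + k + P
greedy-bound-side {k} {P} {ℓ = ℓ} {x} ℓ≤x _ (inj₁ refl) =
  ≤-by-identity (x + k + P) (*-monoʳ-≤′ 3 ℓ≤x) (solve (k ∷ P ∷ ℓ ∷ x ∷ []))
greedy-bound-side {k} {P} {ℓ = ℓ} {x} _ 3ℓ≤ (inj₂ refl) =
  ≤-by-identity k 3ℓ≤ (solve (k ∷ P ∷ ℓ ∷ x ∷ []))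

greedy-bound-rest : ∀ {k P c I ℓ r x y} → r ≤ I → ℓ + r ≤ k → 3 * r ≤ 4 * c + P → 2 * x ≤ k →
  y ≡ I ⊎ y ≡ c ⊎ x + y ≡ k → 3 * r ≤ 4 * y + k + P
greedy-bound-rest {c = c} r≤I _ 3r≤ _ (inj₁ y≡I)        = greedy-bound-side {c = c} r≤I 3r≤ (inj₁ y≡I)
greedy-bound-rest {c = c} r≤I _ 3r≤ _ (inj₂ (inj₁ y≡c)) = greedy-bound-side {c = c} r≤I 3r≤ (inj₂ y≡c)
greedy-bound-rest {k} {P} {ℓ = ℓ} {r} {x} {y} _ ℓ+r≤k _ 2x≤k (inj₂ (inj₂ x+y≡k)) =
  ≤-by-identity (P + 3 * ℓ)
    (+-mono-≤ (+-mono-≤ (*-monoʳ-≤′ 4 (≤-reflexive (sym x+y≡k))) (*-monoʳ-≤′ 2 2x≤k))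
              (*-monoʳ-≤′ 3 ℓ+r≤k))
    (solve (k ∷ P ∷ ℓ ∷ r ∷ x ∷ y ∷ []))

greedy-bound-total : ∀ {k P cℓ cr Iℓ Ir ℓ r x y} → k ≤ cℓ + cr →
  ℓ ≤ Iℓ → r ≤ Ir → ℓ + r ≤ k → 3 * ℓ ≤ 4 * cℓ + P → 3 * r ≤ 4 * cr + P →
  x ≡ Iℓ ⊎ x ≡ cℓ → y ≡ Ir ⊎ y ≡ cr ⊎ x + y ≡ k → 3 * (ℓ + r) ≤ 4 * (x + y) + P
greedy-bound-total {k} {P} {ℓ = ℓ} {r} {x} {y} _ _ _ ℓ+r≤k _ _ _ (inj₂ (inj₂ x+y≡k)) =
  ≤-by-identity (x + y + P) (*-monoʳ-≤′ 3 (≤-trans ℓ+r≤k (≤-reflexive (sym x+y≡k))))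
    (solve (P ∷ ℓ ∷ r ∷ x ∷ y ∷ []))
greedy-bound-total {P = P} {ℓ = ℓ} {r} {x} {y} _ ℓ≤x r≤y _ _ _ (inj₁ refl) (inj₁ refl) =
  ≤-by-identity (x + y + P) (*-monoʳ-≤′ 3 (+-mono-≤ ℓ≤x r≤y)) (solve (P ∷ ℓ ∷ r ∷ x ∷ y ∷ []))
greedy-bound-total {P = P} {ℓ = ℓ} {r} {x} {y} _ ℓ≤x _ _ _ 3r≤ (inj₁ refl) (inj₂ (inj₁ refl)) =
  ≤-by-identity x (+-mono-≤ (*-monoʳ-≤′ 3 ℓ≤x) 3r≤) (solve (P ∷ ℓ ∷ r ∷ x ∷ y ∷ []))
greedy-bound-total {P = P} {ℓ = ℓ} {r} {x} {y} _ _ r≤y _ 3ℓ≤ _ (inj₂ refl) (inj₁ refl) =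
  ≤-by-identity y (+-mono-≤ 3ℓ≤ (*-monoʳ-≤′ 3 r≤y)) (solve (P ∷ ℓ ∷ r ∷ x ∷ y ∷ []))
greedy-bound-total {k} {P} {ℓ = ℓ} {r} {x} {y} k≤x+y _ _ ℓ+r≤k _ _ (inj₂ refl) (inj₂ (inj₁ refl)) =
  ≤-by-identity (x + y + P) (*-monoʳ-≤′ 3 (≤-trans ℓ+r≤k k≤x+y)) (solve (P ∷ ℓ ∷ r ∷ x ∷ y ∷ []))

greedy-stage : ∀ {k P cℓ cr Iℓ Ir ℓ r x y} → k ≤ cℓ + cr →
  ℓ ≤ Iℓ → r ≤ Ir → ℓ + r ≤ k → 3 * ℓ ≤ 4 * cℓ + P → 3 * r ≤ 4 * cr + P → 2 * x ≤ k →
  x ≡ Iℓ ⊎ x ≡ cℓ → y ≡ Ir ⊎ y ≡ cr ⊎ x + y ≡ k →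
  3 * (ℓ + r) + potential k (x , y) (ℓ , r) ≤ 4 * (x + y) + P
greedy-stage {k} {P} {ℓ = ℓ} {r} {x} {y} k≤cℓ+cr ℓ≤Iℓ r≤Ir ℓ+r≤k 3ℓ≤ 3r≤ 2x≤k x-sel y-sel =
  +-potential-≤ {k} {x} {y} {ℓ} {r}
    (greedy-bound-total k≤cℓ+cr ℓ≤Iℓ r≤Ir ℓ+r≤k 3ℓ≤ 3r≤ x-sel y-sel)
    (≤-by-identity 0 (greedy-bound-side {k} ℓ≤Iℓ 3ℓ≤ x-sel) (solve (k ∷ P ∷ ℓ ∷ r ∷ x ∷ y ∷ [])))
    (≤-by-identity 0 (greedy-bound-rest r≤Ir ℓ+r≤k 3r≤ 2x≤k y-sel) (solve (k ∷ P ∷ ℓ ∷ r ∷ x ∷ y ∷ [])))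

greedy-stage-mirrored : ∀ {k P ℓ r x y} →
  3 * (r + ℓ) + potential k (y , x) (r , ℓ) ≤ 4 * (y + x) + P →
  3 * (ℓ + r) + potential k (x , y) (ℓ , r) ≤ 4 * (x + y) + P
greedy-stage-mirrored {k} {P} {ℓ} {r} {x} {y} = subst₂ _≤_
  (cong₂ _+_ (cong (3 *_) (+-comm r ℓ)) (potential-mirror k x y ℓ r))
  (cong (λ t → 4 * t + P) (+-comm y x))

-- Only the average over the coin works: for odd k, ℓ = 0, r = k and P = 0
-- the outcome (⌈k/2⌉ , ⌊k/2⌋) alone leaves Ψ = k + 2.
rounding-stage : ∀ {k u v ℓ r} P → u + v ≡ k → v ≤ u → u ≤ v + 1 → 1 ≤ v → ℓ + r ≤ k →
  6 * (ℓ + r) + (potential k (v , u) (ℓ , r) + potential k (u , v) (ℓ , r))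
    ≤ 4 * ((v + u) + (u + v)) + 2 * P
rounding-stage {u = u} {v} {ℓ} {r} P refl v≤u u≤v+1 1≤v ℓ+r≤k = begin
  6 * (ℓ + r) + (Ψ₁ + Ψ₂)   ≡⟨ sym (+-assoc (6 * (ℓ + r)) Ψ₁ Ψ₂) ⟩
  6 * (ℓ + r) + Ψ₁ + Ψ₂     ≤⟨ bound ⟩
  8 * (u + v)               ≤⟨ ≤-by-identity (2 * P) (≤-refl {0}) (solve (P ∷ u ∷ v ∷ [])) ⟩
  4 * ((v + u) + (u + v)) + 2 * P ∎
  where
    open ≤-Reasoning
    Ψ₁ Ψ₂ : ℕ
    Ψ₁ = potential (u + v) (v , u) (ℓ , r)
    Ψ₂ = potential (u + v) (u , v) (ℓ , r)
    6ℓr : 6 * (ℓ + r) ≤ 6 * (u + v)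
    6ℓr = *-monoʳ-≤′ 6 ℓ+r≤k
    reassoc : ∀ w x Ψ {z} → w + x + Ψ ≤ z → w + Ψ + x ≤ z
    reassoc w x Ψ {z} = subst (_≤ z) (xy∙z≈xz∙y w x Ψ)
    bound : 6 * (ℓ + r) + Ψ₁ + Ψ₂ ≤ 8 * (u + v)
    bound = +-potential-≤ {u + v} {u} {v} {ℓ} {r}
      (+-potential-≤ {u + v} {v} {u} {ℓ} {r}
        (≤-by-identity (2 * (u + v)) 6ℓr (solve (ℓ ∷ r ∷ u ∷ v ∷ [])))
        (≤-by-identity (v + 3 * r) (+-mono-≤ (+-mono-≤ 6ℓr u≤v+1) 1≤v) (solve (ℓ ∷ r ∷ u ∷ v ∷ [])))
        (≤-by-identity (2 * u + 3 * ℓ) (+-mono-≤ 6ℓr v≤u) (solve (ℓ ∷ r ∷ u ∷ v ∷ []))))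
      (reassoc (6 * (ℓ + r)) (4 * v) Ψ₁ (+-potential-≤ {u + v} {v} {u} {ℓ} {r}
        (≤-by-identity (2 * u + 3 * r) (+-mono-≤ 6ℓr v≤u) (solve (ℓ ∷ r ∷ u ∷ v ∷ [])))
        (≤-by-identity (6 * r) 6ℓr (solve (ℓ ∷ r ∷ u ∷ v ∷ [])))
        (≤-by-identity (6 * u) (+-mono-≤ (*-monoʳ-≤′ 3 ℓ+r≤k) v≤u) (solve (ℓ ∷ r ∷ u ∷ v ∷ [])))))
      (reassoc (6 * (ℓ + r)) (4 * u) Ψ₁ (+-potential-≤ {u + v} {v} {u} {ℓ} {r}
        (≤-by-identity (v + 3 * ℓ) (+-mono-≤ (+-mono-≤ 6ℓr u≤v+1) 1≤v) (solve (ℓ ∷ r ∷ u ∷ v ∷ [])))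
        (≤-by-identity (u + 3 * v)
          (+-mono-≤ (+-mono-≤ (*-monoʳ-≤′ 3 ℓ+r≤k) (*-monoʳ-≤′ 2 u≤v+1)) (*-monoʳ-≤′ 2 1≤v))
          (solve (ℓ ∷ r ∷ u ∷ v ∷ [])))
        (≤-by-identity (6 * ℓ) 6ℓr (solve (ℓ ∷ r ∷ u ∷ v ∷ [])))))

data StageCase (k a b Iℓ Ir : ℕ) : Set where
  ℓ-first : capℓ k a b ≤ half k ⊎ Iℓ ≤ half k →
            (∀ c → stepPrGBA k (a , b) (Iℓ , Ir) c
                   ≡ (Iℓ ⊓ capℓ k a b , (Ir ⊓ capr k a b) ⊓ (k ∸ (Iℓ ⊓ capℓ k a b)))) →
            StageCase k a b Iℓ Ir
  r-first : capr k a b ≤ half k ⊎ Ir ≤ half k →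
            (∀ c → stepPrGBA k (a , b) (Iℓ , Ir) c
                   ≡ ((Iℓ ⊓ capℓ k a b) ⊓ (k ∸ (Ir ⊓ capr k a b)) , Ir ⊓ capr k a b)) →
            StageCase k a b Iℓ Ir
  rounded : (∀ c → stepPrGBA k (a , b) (Iℓ , Ir) c ≡ (k ∸ prrdHalf k c , prrdHalf k c)) →
            StageCase k a b Iℓ Ir

stageCase : ∀ k a b Iℓ Ir → StageCase k a b Iℓ Ir
stageCase k a b Iℓ Ir with (capℓ k a b ≤ᵇ half k) ∨ (Iℓ ≤ᵇ half k) in ℓ-test
                         | (capr k a b ≤ᵇ half k) ∨ (Ir ≤ᵇ half k) in r-test
... | true  | _     = ℓ-first (≤ᵇ-∨-true ℓ-test) λ _ → if-cong ℓ-test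
... | false | true  = r-first (≤ᵇ-∨-true r-test) λ _ → trans (if-cong ℓ-test) (if-cong r-test)
... | false | false = rounded λ _ → trans (if-cong ℓ-test) (if-cong r-test)

accepted : ℕ × ℕ → ℕ
accepted (x , y) = x + y

stepPrGBA-≤k : ∀ {k a b} Iℓ Ir → ∀ c → accepted (stepPrGBA k (a , b) (Iℓ , Ir) c) ≤ k
stepPrGBA-≤k {k} {a} {b} Iℓ Ir c with stageCase k a b Iℓ Ir
... | ℓ-first small step rewrite step c =
  x+[y⊓[k∸x]]≤k (Ir ⊓ capr k a b) (twice≤⇒≤ (twice-⊓≤ Iℓ (capℓ k a b) small))
... | r-first small step rewrite step c =
  subst (_≤ k) (+-comm (Ir ⊓ capr k a b) ((Iℓ ⊓ capℓ k a b) ⊓ (k ∸ (Ir ⊓ capr k a b))))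
    (x+[y⊓[k∸x]]≤k (Iℓ ⊓ capℓ k a b) (twice≤⇒≤ (twice-⊓≤ Ir (capr k a b) small)))
... | rounded step rewrite step c = ≤-reflexive (m∸n+n≡m (prrdHalf≤k k c))

coinSum : (Bool → ℕ) → ℕ
coinSum f = f true + f false

doubled : ∀ {s Ψ g P} → 3 * s + Ψ ≤ 4 * g + P → 6 * s + (Ψ + Ψ) ≤ 4 * (g + g) + 2 * P
doubled {s} {Ψ} {g} {P} h = ≤-by-identity 0 (+-mono-≤ h h) (solve (s ∷ Ψ ∷ g ∷ P ∷ []))

stage-bound : ∀ {k} → 2 ≤ k → ∀ {a b p q ℓ r} Iℓ Ir → a + b ≤ k →
  ℓ ≤ Iℓ → r ≤ Ir → ℓ + p ≤ k → r + q ≤ k → ℓ + r ≤ k →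
  6 * (ℓ + r) + coinSum (λ c → potential k (stepPrGBA k (a , b) (Iℓ , Ir) c) (ℓ , r))
    ≤ 4 * coinSum (λ c → accepted (stepPrGBA k (a , b) (Iℓ , Ir) c)) + 2 * potential k (a , b) (p , q)
stage-bound {k} 2≤k {a} {b} {p} {q} {ℓ} {r} Iℓ Ir a+b≤k ℓ≤Iℓ r≤Ir ℓ+p≤k r+q≤k ℓ+r≤k
  with stageCase k a b Iℓ Ir
... | ℓ-first small step rewrite step true | step false =
  doubled {ℓ + r} {potential k (x , y) (ℓ , r)} {x + y} {P}
    (greedy-stage {k} {P} {ℓ = ℓ} {r} {x} {y}
      (k≤capℓ+capr a b a+b≤k) ℓ≤Iℓ r≤Ir ℓ+r≤k
      (opt-below-capℓ a b p q a+b≤k ℓ+p≤k) (opt-below-capr a b p q a+b≤k r+q≤k)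
      2x≤k (⊓-sel Iℓ (capℓ k a b)) (⊓-∸-sel Ir (capr k a b) (twice≤⇒≤ 2x≤k)))
  where
    P = potential k (a , b) (p , q)
    x = Iℓ ⊓ capℓ k a b
    y = (Ir ⊓ capr k a b) ⊓ (k ∸ x)
    2x≤k = twice-⊓≤ Iℓ (capℓ k a b) small
... | r-first small step rewrite step true | step false =
  doubled {ℓ + r} {potential k (x , y) (ℓ , r)} {x + y} {P}
    (greedy-stage-mirrored {k} {P} {ℓ} {r} {x} {y}
      (greedy-stage {k} {P} {capr k a b} {capℓ k a b} {Ir} {Iℓ} {r} {ℓ} {y} {x}
        (subst (k ≤_) (+-comm (capℓ k a b) (capr k a b)) (k≤capℓ+capr a b a+b≤k))
        r≤Ir ℓ≤Iℓ (subst (_≤ k) (+-comm ℓ r) ℓ+r≤k)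
        (opt-below-capr a b p q a+b≤k r+q≤k) (opt-below-capℓ a b p q a+b≤k ℓ+p≤k)
        2y≤k (⊓-sel Ir (capr k a b)) (⊓-∸-sel Iℓ (capℓ k a b) (twice≤⇒≤ 2y≤k))))
  where
    P = potential k (a , b) (p , q)
    y = Ir ⊓ capr k a b
    x = (Iℓ ⊓ capℓ k a b) ⊓ (k ∸ y)
    2y≤k = twice-⊓≤ Ir (capr k a b) small
... | rounded step rewrite step true | step false | m∸[m∸n]≡n (m/n≤m k 2) =
  rounding-stage {k} {k ∸ half k} {half k} {ℓ} {r} (potential k (a , b) (p , q))
    (ceil+half≡k k) (half≤ceil k) (ceil≤half+1 k) (1≤half 2≤k) ℓ+r≤k

totalProfitFrom : (k : ℕ) → ℕ × ℕ → {n : ℕ} → Instance n → ℕ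
totalProfitFrom k g {n} I = sum (map (λ bs → profit (runPrGBA k g I bs)) (allBits n))

length-allBits : ∀ n → length (allBits n) ≡ 2 ^ n
length-allBits zero = refl
length-allBits (suc n) = begin
  length (map (true Vec.∷_) (allBits n) ++ map (false Vec.∷_) (allBits n))
    ≡⟨ length-++ (map (true Vec.∷_) (allBits n)) ⟩
  length (map (true Vec.∷_) (allBits n)) + length (map (false Vec.∷_) (allBits n))
    ≡⟨ cong₂ _+_ (length-map (true Vec.∷_) (allBits n)) (length-map (false Vec.∷_) (allBits n)) ⟩
  length (allBits n) + length (allBits n)
    ≡⟨ cong₂ _+_ (length-allBits n) (trans (length-allBits n) (sym (+-identityʳ (2 ^ n)))) ⟩
  2 * 2 ^ n ∎
  where open ≡-Reasoning

sum-map-const+ : ∀ {A : Set} c (h : A → ℕ) (L : List A) →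
  sum (map (λ x → c + h x) L) ≡ length L * c + sum (map h L)
sum-map-const+ c h []       = refl
sum-map-const+ c h (x ∷ L) = begin
  c + h x + sum (map (λ x → c + h x) L)       ≡⟨ cong (c + h x +_) (sum-map-const+ c h L) ⟩
  c + h x + (length L * c + sum (map h L))    ≡⟨ shuffle c (h x) (length L) (sum (map h L)) ⟩
  c + length L * c + (h x + sum (map h L))    ∎
  where
    open ≡-Reasoning
    shuffle : ∀ c a l s → c + a + (l * c + s) ≡ c + l * c + (a + s)
    shuffle = solve-∀

totalProfitFrom-∷ : ∀ k g {n} x (I : Instance n) →
  totalProfitFrom k g (x Vec.∷ I)
    ≡ coinSum (λ c → 2 ^ n * accepted (stepPrGBA k g x c) + totalProfitFrom k (stepPrGBA k g x c) I)
totalProfitFrom-∷ k g {n} x I = begin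
  sum (map profitFrom (map (true Vec.∷_) L ++ map (false Vec.∷_) L))
    ≡⟨ cong sum (map-++ profitFrom (map (true Vec.∷_) L) (map (false Vec.∷_) L)) ⟩
  sum (map profitFrom (map (true Vec.∷_) L) ++ map profitFrom (map (false Vec.∷_) L))
    ≡⟨ sum-++ (map profitFrom (map (true Vec.∷_) L)) (map profitFrom (map (false Vec.∷_) L)) ⟩
  sum (map profitFrom (map (true Vec.∷_) L)) + sum (map profitFrom (map (false Vec.∷_) L))
    ≡⟨ cong₂ _+_ (coin true) (coin false) ⟩
  coinSum (λ c → 2 ^ n * accepted (next c) + totalProfitFrom k (next c) I) ∎
  where
    open ≡-Reasoning
    L = allBits n
    next = stepPrGBA k g x
    profitFrom = λ bs → profit (runPrGBA k g (x Vec.∷ I) bs)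
    coin : ∀ c → sum (map profitFrom (map (c Vec.∷_) L))
                 ≡ 2 ^ n * accepted (next c) + totalProfitFrom k (next c) I
    coin c = begin
      sum (map profitFrom (map (c Vec.∷_) L))
        ≡⟨ cong sum (map-∘ L) ⟨
      sum (map (λ bs → accepted (next c) + profit (runPrGBA k (next c) I bs)) L)
        ≡⟨ sum-map-const+ (accepted (next c)) (λ bs → profit (runPrGBA k (next c) I bs)) L ⟩
      length L * accepted (next c) + totalProfitFrom k (next c) I
        ≡⟨ cong (λ m → m * accepted (next c) + totalProfitFrom k (next c) I) (length-allBits n) ⟩
      2 ^ n * accepted (next c) + totalProfitFrom k (next c) I ∎

amortised-step : ∀ N s g Ψ (F G Ψ′ : Bool → ℕ) →
  (∀ c → 3 * N * s ≤ 4 * F c + N * Ψ′ c) →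
  6 * g + coinSum Ψ′ ≤ 4 * coinSum G + 2 * Ψ →
  3 * (2 * N) * (g + s) ≤ 4 * coinSum (λ c → N * G c + F c) + 2 * N * Ψ
amortised-step N s g Ψ F G Ψ′ rest stage =
  ≤-by-identity 0 (+-mono-≤ (+-mono-≤ (rest true) (rest false)) (*-monoʳ-≤′ N stage))
    (shuffle N s g Ψ (F true) (F false) (G true) (G false) (Ψ′ true) (Ψ′ false))
  where
    shuffle : ∀ N s g Ψ F₁ F₂ G₁ G₂ Ψ₁ Ψ₂ →
      4 * ((N * G₁ + F₁) + (N * G₂ + F₂)) + 2 * N * Ψ
        + (3 * N * s + 3 * N * s + N * (6 * g + (Ψ₁ + Ψ₂)))
      ≡ 3 * (2 * N) * (g + s)
        + ((4 * F₁ + N * Ψ₁) + (4 * F₂ + N * Ψ₂) + N * (4 * (G₁ + G₂) + 2 * Ψ)) + 0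
    shuffle = solve-∀

potential-invariant : ∀ {k} → 2 ≤ k → ∀ {n} (I : Instance n) (S : Choice n) {a b p q} →
  a + b ≤ k → p + q ≤ k → Feasible k p q I S →
  3 * 2 ^ n * profit S ≤ 4 * totalProfitFrom k (a , b) I + 2 ^ n * potential k (a , b) (p , q)
potential-invariant 2≤k Vec.[] Vec.[] _ _ _ = z≤n
potential-invariant {k} 2≤k {suc n} ((Iℓ , Ir) Vec.∷ I) ((ℓ , r) Vec.∷ S) {a} {b} {p} {q}
  a+b≤k p+q≤k (ℓ≤Iℓ , r≤Ir , ℓ≤capℓ , r≤capr , ℓ+r≤k , feasible) =
  subst (λ T → 3 * 2 ^ suc n * (ℓ + r + profit S) ≤ 4 * T + 2 ^ suc n * potential k (a , b) (p , q))
    (sym (totalProfitFrom-∷ k (a , b) (Iℓ , Ir) I))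
    (amortised-step (2 ^ n) (profit S) (ℓ + r) (potential k (a , b) (p , q))
      (λ c → totalProfitFrom k (next c) I) (λ c → accepted (next c)) (λ c → potential k (next c) (ℓ , r))
      (λ c → potential-invariant 2≤k I S (stepPrGBA-≤k {k} {a} {b} Iℓ Ir c) ℓ+r≤k feasible)
      (stage-bound 2≤k {a} {b} {p} {q} Iℓ Ir a+b≤k ℓ≤Iℓ r≤Ir ℓ+p≤k r+q≤k ℓ+r≤k))
  where
    next = stepPrGBA k (a , b) (Iℓ , Ir)
    ℓ+p≤k = ≤-trans (+-monoˡ-≤ p ℓ≤capℓ) (≤-reflexive (capℓ+a≡k p q p+q≤k))
    r+q≤k = ≤-trans (+-monoˡ-≤ q r≤capr) (≤-reflexive (capr+b≡k p q p+q≤k))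

theorem4 : (k : ℕ) → 2 ≤ k → (n : ℕ) (I : Instance n) (S : Choice n)
             → Feasible k 0 0 I S
             → 3 * (2 ^ n) * profit S ≤ 4 * totalProfitPrGBA k I
theorem4 k 2≤k n I S feasible = begin
  3 * 2 ^ n * profit S
    ≤⟨ potential-invariant 2≤k I S z≤n z≤n feasible ⟩
  4 * totalProfitPrGBA k I + 2 ^ n * potential k (0 , 0) (0 , 0)
    ≡⟨ cong (λ Ψ → 4 * totalProfitPrGBA k I + 2 ^ n * Ψ) (potential-origin k) ⟩
  4 * totalProfitPrGBA k I + 2 ^ n * 0
    ≡⟨ cong (4 * totalProfitPrGBA k I +_) (*-zeroʳ (2 ^ n)) ⟩
  4 * totalProfitPrGBA k I + 0
    ≡⟨ +-identityʳ _ ⟩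
  4 * totalProfitPrGBA k I ∎
  where open ≤-Reasoning
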